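{- Let $w=w_1\cdots w_n\in\mathfrak S_n$, and let $\gamma=w_iw_{i+1}\cdots w_j$ and $\delta=w_{i'}w_{i'+1}\cdots w_{j'}$ each be a maximal $k$-ascending section or a maximal $k$-descending section of $w$. If $j<i'$, then the section $w_jw_{j+1}\cdots w_{i'}$ contains a $k$-up or a $k$-down, i.e., there are $j\le s<t\le i'$ with $|w_s-w_t|\ge k$.
   Context: Let $n\ge2$, $1\le k\le n-1$, and $\mathfrak S_n$ the permutations of $\{1,\dots,n\}$ in one-line notation $w=w_1\cdots w_n$. A section of $w$ is a consecutive segment $w_sw_{s+1}\cdots w_t$. A section $w_s\cdots w_t$ is a $k$-up if $s<t$ and $w_t-w_s\ge k$, and a $k$-down if $s<t$ and $w_s-w_t\ge k$. A section $w_i\cdots w_j$ with $i<j$ is $k$-ascending if (1) $w_i=\min\{w_i,\dots,w_j\}$ and $w_j=\max\{w_i,\dots,w_j\}$; (2) $w_j-w_i\ge k$; (3) there are no $i\le s<t\le j$ with $w_s-w_t\ge k$. It is $k$-descending if (1) $w_i=\max\{w_i,\dots,w_j\}$ and $w_j=\min\{w_i,\dots,w_j\}$; (2) $w_i-w_j\ge k$; (3) there are no $i\le s<t\le j$ with $w_t-w_s\ge k$. A $k$-ascending (resp. $k$-descending) section is maximal if it is not contained in another $k$-ascending (resp. $k$-descending) section. -}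

module Defs where

open import Data.Nat using (ℕ; _+_; _≤_; _<_)
open import Data.Fin using (Fin; toℕ)
open import Data.Product using (_×_; ∃₂)
open import Data.Sum using (_⊎_)
open import Relation.Nullary using (¬_)
open import Relation.Binary.PropositionalEquality using (_≡_)
open import Function.Bundles using (Bijection)
open import Relation.Binary.PropositionalEquality using (setoid)

-- A permutation of {1,…,n} in one-line notation, encoded 0-based:
-- positions and values are Fin n, and w is a bijection Fin n → Fin n.
-- Positions are compared/ordered via toℕ; values via toℕ (0-based shift
-- does not affect differences).
record Perm (n : ℕ) : Set where
  field
    w   : Fin n → Fin n
    bij : Bijection (setoid (Fin n)) (setoid (Fin n))
    bij-is-w : ∀ x → Bijection.to bij x ≡ w x

open Perm public

val : ∀ {n} → Perm n → Fin n → ℕ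
val π p = toℕ (w π p)

InSec : ∀ {n} → Fin n → Fin n → Fin n → Set
InSec i j p = toℕ i ≤ toℕ p × toℕ p ≤ toℕ j

KAscending : ∀ {n} → Perm n → ℕ → Fin n → Fin n → Set
KAscending π k i j =
  toℕ i < toℕ j
  × (∀ p → InSec i j p → val π i ≤ val π p)
  × (∀ p → InSec i j p → val π p ≤ val π j)
  × (val π i + k ≤ val π j)
  × (∀ s t → InSec i j s → InSec i j t → toℕ s < toℕ t →
       ¬ (val π t + k ≤ val π s))

KDescending : ∀ {n} → Perm n → ℕ → Fin n → Fin n → Set
KDescending π k i j =
  toℕ i < toℕ j
  × (∀ p → InSec i j p → val π p ≤ val π i)
  × (∀ p → InSec i j p → val π j ≤ val π p)
  × (val π j + k ≤ val π i)
  × (∀ s t → InSec i j s → InSec i j t → toℕ s < toℕ t →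
       ¬ (val π s + k ≤ val π t))

Maximal : ∀ {n} → (Fin n → Fin n → Set) → Fin n → Fin n → Set
Maximal P i j =
  P i j × (∀ i' j' → P i' j' → toℕ i' ≤ toℕ i → toℕ j ≤ toℕ j' →
             (i' ≡ i × j' ≡ j))

MaxKAscending : ∀ {n} → Perm n → ℕ → Fin n → Fin n → Set
MaxKAscending π k = Maximal (KAscending π k)

MaxKDescending : ∀ {n} → Perm n → ℕ → Fin n → Fin n → Set
MaxKDescending π k = Maximal (KDescending π k)

MaxKSection : ∀ {n} → Perm n → ℕ → Fin n → Fin n → Set
MaxKSection π k i j = MaxKAscending π k i j ⊎ MaxKDescending π k i j

-- Suppose w_j … w_{i'} contains no k-up and no k-down. If γ and δ are both
-- k-ascending, then γ, w_j … w_{i'} and δ glue into one k-ascending section: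
-- every value of the middle piece exceeds w_j − k ≥ w_i and is below
-- w_{i'} + k ≤ w_{j'}. This contradicts the maximality of γ. If γ is
-- k-ascending and δ is k-descending, maximality of γ forces w_j to be the
-- largest value of w_j … w_{i'} (otherwise γ extends up to the position of
-- that maximum), and then δ extends to the left to start at j, contradicting
-- the maximality of δ. The other two cases are the same arguments with the
-- order on values reversed, so everything is proved once for a total order
-- with a "gap" relation a ≪ b, which for ℕ is a + k ≤ b.
module Submission where

open import Defs
open import Level using (0ℓ)
open import Data.Nat using (ℕ; _+_; _≤_; _<_; _≤?_; _<?_)
open import Data.Nat.Properties
  using (≤-refl; ≤-trans; <⇒≤; ≰⇒>; <-trans; <-≤-trans; ≤-<-trans; <-irrefl;
         m<m+n; m≤n⇒m<n∨m≡n; +-monoˡ-≤; ≤-totalOrder)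
open import Data.Fin using (Fin; toℕ)
open import Data.Fin.Properties using (toℕ-injective; any?)
open import Data.Product using (_×_; Σ-syntax; _,_; proj₁; proj₂)
open import Data.Sum using (_⊎_; inj₁; inj₂)
open import Data.Empty using (⊥; ⊥-elim)
open import Data.List using (allFin; filter)
open import Data.List.Relation.Unary.All using (lookup)
open import Data.List.Relation.Unary.All.Properties using (all-filter)
open import Data.List.Membership.Propositional.Properties using (∈-allFin; ∈-filter⁺)
import Data.List.Extrema as Extrema
open import Relation.Nullary using (¬_; Dec; yes; no)
open import Relation.Nullary.Decidable using (_×-dec_; _⊎-dec_)
open import Relation.Binary using (Rel; TotalOrder)
import Relation.Binary.Construct.Flip.EqAndOrd as Flip
open import Relation.Binary.PropositionalEquality using (_≡_; refl; subst; cong; sym)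

inSec? : ∀ {n} (a b p : Fin n) → Dec (InSec a b p)
inSec? a b p = (toℕ a ≤? toℕ p) ×-dec (toℕ p ≤? toℕ b)

InSec-⊆ : ∀ {n} {a b a' b' p : Fin n} → toℕ a ≤ toℕ a' → toℕ b' ≤ toℕ b →
          InSec a' b' p → InSec a b p
InSec-⊆ a≤a' b'≤b (a'≤p , p≤b') = ≤-trans a≤a' a'≤p , ≤-trans p≤b' b'≤b

InSec-split : ∀ {n} {Q : Fin n → Set} {a b c : Fin n} →
              (∀ p → InSec a b p → Q p) → (∀ p → InSec b c p → Q p) →
              ∀ p → InSec a c p → Q p
InSec-split {b = b} left right p (a≤p , p≤c) with toℕ p ≤? toℕ b
... | yes p≤b = left p (a≤p , p≤b)
... | no p≰b = right p (<⇒≤ (≰⇒> p≰b) , p≤c)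

record Gap (O : TotalOrder 0ℓ 0ℓ 0ℓ) : Set₁ where
  open TotalOrder O using (Carrier) renaming (_≤_ to _⊑_)
  field
    _≪_ : Rel Carrier 0ℓ
    ≪-irrefl : ∀ {a} → ¬ a ≪ a
    ≪-⊑-trans : ∀ {a b c} → a ≪ b → b ⊑ c → a ≪ c
    ⊑-≪-trans : ∀ {a b c} → a ⊑ b → b ≪ c → a ≪ c

flipGap : ∀ {O} → Gap O → Gap (Flip.totalOrder O)
flipGap G = record
  { _≪_ = λ a b → b ≪ a
  ; ≪-irrefl = ≪-irrefl
  ; ≪-⊑-trans = λ b≪a c⊑b → ⊑-≪-trans c⊑b b≪a
  ; ⊑-≪-trans = λ b⊑a c≪b → ≪-⊑-trans c≪b b⊑a
  } where open Gap G

module Sections (O : TotalOrder 0ℓ 0ℓ 0ℓ) (G : Gap O)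
                {n : ℕ} (v : Fin n → TotalOrder.Carrier O) where
  open TotalOrder O using () renaming (_≤_ to _⊑_; trans to ⊑-trans; total to ⊑-total)
  open Gap G
  open Extrema O using (argmax; argmax-all; f[xs]≤f[argmax])

  ≪-¬≪ʳ⇒⊑ : ∀ {a b c} → a ≪ c → ¬ b ≪ c → a ⊑ b
  ≪-¬≪ʳ⇒⊑ {a} {b} a≪c ¬b≪c with ⊑-total a b
  ... | inj₁ a⊑b = a⊑b
  ... | inj₂ b⊑a = ⊥-elim (¬b≪c (⊑-≪-trans b⊑a a≪c))

  ≪-¬≪ˡ⇒⊑ : ∀ {a b c} → a ≪ c → ¬ a ≪ b → b ⊑ c
  ≪-¬≪ˡ⇒⊑ {b = b} {c} a≪c ¬a≪b with ⊑-total b c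
  ... | inj₁ b⊑c = b⊑c
  ... | inj₂ c⊑b = ⊥-elim (¬a≪b (≪-⊑-trans a≪c c⊑b))

  argmaxOn : ∀ a b → toℕ a ≤ toℕ b →
             Σ[ m ∈ Fin n ] (InSec a b m × (∀ p → InSec a b p → v p ⊑ v m))
  argmaxOn a b a≤b =
    argmax v a section ,
    argmax-all v (≤-refl , a≤b) (all-filter (inSec? a b) (allFin n)) ,
    λ p p∈[a,b] → lookup (f[xs]≤f[argmax] {f = v} a section)
                         (∈-filter⁺ (inSec? a b) (∈-allFin p) p∈[a,b])
    where section = filter (inSec? a b) (allFin n)

  NoDown : Fin n → Fin n → Set
  NoDown a b = ∀ s t → InSec a b s → InSec a b t → toℕ s < toℕ t → ¬ v t ≪ v s

  Ascending : Fin n → Fin n → Set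
  Ascending i j =
    toℕ i < toℕ j
    × (∀ p → InSec i j p → v i ⊑ v p)
    × (∀ p → InSec i j p → v p ⊑ v j)
    × v i ≪ v j
    × NoDown i j

  noDown-⊆ : ∀ {a b a' b'} → toℕ a ≤ toℕ a' → toℕ b' ≤ toℕ b →
             NoDown a b → NoDown a' b'
  noDown-⊆ a≤a' b'≤b nd s t hs ht =
    nd s t (InSec-⊆ a≤a' b'≤b hs) (InSec-⊆ a≤a' b'≤b ht)

  noDown-¬≪ˡ : ∀ {a b p} → NoDown a b → InSec a b p → ¬ v p ≪ v a
  noDown-¬≪ˡ {a} {p = p} nd (a≤p , p≤b) with m≤n⇒m<n∨m≡n a≤p
  ... | inj₁ a<p = nd a p (≤-refl , ≤-trans a≤p p≤b) (a≤p , p≤b) a<p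
  ... | inj₂ a≡p rewrite toℕ-injective a≡p = ≪-irrefl

  noDown-¬≪ʳ : ∀ {a b p} → NoDown a b → InSec a b p → ¬ v b ≪ v p
  noDown-¬≪ʳ {b = b} {p} nd (a≤p , p≤b) with m≤n⇒m<n∨m≡n p≤b
  ... | inj₁ p<b = nd p b (a≤p , p≤b) (≤-trans a≤p p≤b , ≤-refl) p<b
  ... | inj₂ p≡b rewrite toℕ-injective p≡b = ≪-irrefl

  -- A down from s < b to t > b would, by the bound at b, give a down from b
  -- to t (resp. from s to b).
  noDown-joinˡ : ∀ {a b c} → NoDown a b → NoDown b c →
                 (∀ s → InSec a b s → v s ⊑ v b) → NoDown a c
  noDown-joinˡ {b = b} nd₁ nd₂ b-max s t (a≤s , s≤c) (a≤t , t≤c) s<t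
    with toℕ t ≤? toℕ b | toℕ b ≤? toℕ s
  ... | yes t≤b | _ = nd₁ s t (a≤s , ≤-trans (<⇒≤ s<t) t≤b) (a≤t , t≤b) s<t
  ... | no _ | yes b≤s = nd₂ s t (b≤s , s≤c) (≤-trans b≤s (<⇒≤ s<t) , t≤c) s<t
  ... | no t≰b | no s≰b = λ t≪s →
    nd₂ b t (≤-refl , ≤-trans (<⇒≤ b<t) t≤c) (<⇒≤ b<t , t≤c) b<t
        (≪-⊑-trans t≪s (b-max s (a≤s , <⇒≤ (≰⇒> s≰b))))
    where b<t = ≰⇒> t≰b

  noDown-joinʳ : ∀ {a b c} → NoDown a b → NoDown b c →
                 (∀ t → InSec b c t → v b ⊑ v t) → NoDown a c
  noDown-joinʳ {b = b} nd₁ nd₂ b-min s t (a≤s , s≤c) (a≤t , t≤c) s<t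
    with toℕ t ≤? toℕ b | toℕ b ≤? toℕ s
  ... | yes t≤b | _ = nd₁ s t (a≤s , ≤-trans (<⇒≤ s<t) t≤b) (a≤t , t≤b) s<t
  ... | no _ | yes b≤s = nd₂ s t (b≤s , s≤c) (≤-trans b≤s (<⇒≤ s<t) , t≤c) s<t
  ... | no t≰b | no s≰b = λ t≪s →
    nd₁ s b (a≤s , <⇒≤ s<b) (≤-trans a≤s (<⇒≤ s<b) , ≤-refl) s<b
        (⊑-≪-trans (b-min t (<⇒≤ (≰⇒> t≰b) , t≤c)) t≪s)
    where s<b = ≰⇒> s≰b

  extendʳ : ∀ {i j m} → Ascending i j → toℕ j ≤ toℕ m →
            (∀ p → InSec j m p → v p ⊑ v m) → NoDown j m → Ascending i m
  extendʳ {j = j} (i<j , i-min , j-max , i≪j , nd) j≤m m-max nd₂ =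
    <-≤-trans i<j j≤m ,
    InSec-split i-min (λ p hp → ≪-¬≪ʳ⇒⊑ i≪j (noDown-¬≪ˡ nd₂ hp)) ,
    InSec-split (λ p hp → ⊑-trans (j-max p hp) j⊑m) m-max ,
    ≪-⊑-trans i≪j j⊑m ,
    noDown-joinˡ nd nd₂ j-max
    where j⊑m = m-max j (≤-refl , j≤m)

  extendˡ : ∀ {i j m} → Ascending i j → toℕ m ≤ toℕ i →
            (∀ p → InSec m i p → v m ⊑ v p) → NoDown m i → Ascending m j
  extendˡ {i = i} (i<j , i-min , j-max , i≪j , nd) m≤i m-min nd₁ =
    ≤-<-trans m≤i i<j ,
    InSec-split m-min (λ p hp → ⊑-trans m⊑i (i-min p hp)) ,
    InSec-split (λ p hp → ≪-¬≪ˡ⇒⊑ i≪j (noDown-¬≪ʳ nd₁ hp)) j-max ,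
    ⊑-≪-trans m⊑i i≪j ,
    noDown-joinʳ nd₁ nd i-min
    where m⊑i = m-min i (m≤i , ≤-refl)

  join : ∀ {i j i' j'} → Ascending i j → Ascending i' j' → toℕ j < toℕ i' →
         NoDown j i' → Ascending i j'
  join {i} {j} {i'} {j'} (i<j , i-min , j-max , i≪j , nd)
                         (i'<j' , i'-min , j'-max , i'≪j' , nd') j<i' nd₀ =
    <-trans i<j (<-trans j<i' i'<j') ,
    InSec-split i-min (InSec-split i-below (λ p hp → ⊑-trans i⊑i' (i'-min p hp))) ,
    InSec-split (λ p hp → ⊑-trans (j-max p hp) j⊑j') (InSec-split j'-above j'-max) ,
    ≪-⊑-trans i≪j j⊑j' ,
    noDown-joinʳ (noDown-joinˡ nd nd₀ j-max) nd' i'-min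
    where
    j≤i' = <⇒≤ j<i'
    i-below : ∀ p → InSec j i' p → v i ⊑ v p
    i-below p hp = ≪-¬≪ʳ⇒⊑ i≪j (noDown-¬≪ˡ nd₀ hp)
    j'-above : ∀ p → InSec j i' p → v p ⊑ v j'
    j'-above p hp = ≪-¬≪ˡ⇒⊑ i'≪j' (noDown-¬≪ʳ nd₀ hp)
    i⊑i' = i-below i' (j≤i' , ≤-refl)
    j⊑j' = j'-above j (≤-refl , j≤i')

  maximal-ascending-top : ∀ {i j m} → Maximal Ascending i j → toℕ j ≤ toℕ m →
                          NoDown j m → ∀ p → InSec j m p → v p ⊑ v j
  maximal-ascending-top {i} {j} {m} (γ , γ-max) j≤m nd p hp
    with argmaxOn j m j≤m
  ... | top , (j≤top , top≤m) , top-max = subst (λ x → v p ⊑ v x) top≡j (top-max p hp)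
    where
    γ' : Ascending i top
    γ' = extendʳ γ j≤top (λ q hq → top-max q (InSec-⊆ ≤-refl top≤m hq))
                 (noDown-⊆ ≤-refl top≤m nd)
    top≡j : top ≡ j
    top≡j = proj₂ (γ-max i top γ' ≤-refl j≤top)

  maximal-ascending-¬join : ∀ {i j i' j'} → Maximal Ascending i j → Ascending i' j' →
                            toℕ j < toℕ i' → ¬ NoDown j i'
  maximal-ascending-¬join {i} {j} {j' = j'} (γ , γ-max) δ j<i' nd =
    <-irrefl (cong toℕ (sym j'≡j)) j<j'
    where
    j<j' = <-trans j<i' (proj₁ δ)
    j'≡j : j' ≡ j
    j'≡j = proj₂ (γ-max i j' (join γ δ j<i' nd) ≤-refl (<⇒≤ j<j'))

  maximal-ascending-¬extendˡ : ∀ {i j m} → Maximal Ascending i j → toℕ m < toℕ i →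
                               (∀ p → InSec m i p → v m ⊑ v p) → ¬ NoDown m i
  maximal-ascending-¬extendˡ {j = j} {m} (δ , δ-max) m<i m-min nd =
    <-irrefl (cong toℕ m≡i) m<i
    where
    m≡i = proj₁ (δ-max m j (extendˡ δ (<⇒≤ m<i) m-min nd) (<⇒≤ m<i) ≤-refl)

kGap : ∀ {k} → 1 ≤ k → Gap ≤-totalOrder
kGap {k} 1≤k = record
  { _≪_ = λ a b → a + k ≤ b
  ; ≪-irrefl = λ {a} a+k≤a → <-irrefl refl (<-≤-trans (m<m+n a 1≤k) a+k≤a)
  ; ≪-⊑-trans = λ a+k≤b b≤c → ≤-trans a+k≤b b≤c
  ; ⊑-≪-trans = λ a≤b b+k≤c → ≤-trans (+-monoˡ-≤ k a≤b) b+k≤c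
  }

-- Up.Ascending is KAscending and Down.Ascending is KDescending, both
-- definitionally; Down.NoDown says that there is no k-up.
module Up {k} (1≤k : 1 ≤ k) {n} (v : Fin n → ℕ) = Sections ≤-totalOrder (kGap 1≤k) v
module Down {k} (1≤k : 1 ≤ k) {n} (v : Fin n → ℕ) =
  Sections (Flip.totalOrder ≤-totalOrder) (flipGap (kGap 1≤k)) v

KJump : ∀ {n} → ℕ → (Fin n → ℕ) → Fin n → Fin n → Set
KJump {n} k v a b =
  Σ[ s ∈ Fin n ] Σ[ t ∈ Fin n ]
    (toℕ a ≤ toℕ s × toℕ s < toℕ t × toℕ t ≤ toℕ b × ((v s + k ≤ v t) ⊎ (v t + k ≤ v s)))

kJump? : ∀ {n} k (v : Fin n → ℕ) a b → Dec (KJump k v a b)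
kJump? k v a b = any? λ s → any? λ t →
  (toℕ a ≤? toℕ s) ×-dec (toℕ s <? toℕ t) ×-dec (toℕ t ≤? toℕ b)
  ×-dec ((v s + k ≤? v t) ⊎-dec (v t + k ≤? v s))

module _ {k} (1≤k : 1 ≤ k) {n} (π : Perm n) where

  ¬kJump⇒noDown : ∀ {a b} → ¬ KJump k (val π) a b → Up.NoDown 1≤k (val π) a b
  ¬kJump⇒noDown ¬jump s t (a≤s , _) (_ , t≤b) s<t down = ¬jump (s , t , a≤s , s<t , t≤b , inj₂ down)

  ¬kJump⇒noUp : ∀ {a b} → ¬ KJump k (val π) a b → Down.NoDown 1≤k (val π) a b
  ¬kJump⇒noUp ¬jump s t (a≤s , _) (_ , t≤b) s<t up = ¬jump (s , t , a≤s , s<t , t≤b , inj₁ up)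

  maximal-sections-separated : ∀ {i j i' j'} →
    MaxKSection π k i j → MaxKSection π k i' j' → toℕ j < toℕ i' →
    Up.NoDown 1≤k (val π) j i' → Down.NoDown 1≤k (val π) j i' → ⊥
  maximal-sections-separated (inj₁ γ) (inj₁ (δ , _)) j<i' noDown _ =
    Up.maximal-ascending-¬join 1≤k (val π) γ δ j<i' noDown
  maximal-sections-separated (inj₂ γ) (inj₂ (δ , _)) j<i' _ noUp =
    Down.maximal-ascending-¬join 1≤k (val π) γ δ j<i' noUp
  maximal-sections-separated (inj₁ γ) (inj₂ δ) j<i' noDown noUp =
    Down.maximal-ascending-¬extendˡ 1≤k (val π) δ j<i'
      (Up.maximal-ascending-top 1≤k (val π) γ (<⇒≤ j<i') noDown) noUp
  maximal-sections-separated (inj₂ γ) (inj₁ δ) j<i' noDown noUp =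
    Up.maximal-ascending-¬extendˡ 1≤k (val π) δ j<i'
      (Down.maximal-ascending-top 1≤k (val π) γ (<⇒≤ j<i') noUp) noDown

lemma2p7 : (n : ℕ) → 2 ≤ n → (k : ℕ) → 1 ≤ k → k + 1 ≤ n →
    (π : Perm n) → (i j i' j' : Fin n) →
    MaxKSection π k i j → MaxKSection π k i' j' →
    toℕ j < toℕ i' →
    Σ[ s ∈ Fin n ] Σ[ t ∈ Fin n ]
      (toℕ j ≤ toℕ s × toℕ s < toℕ t × toℕ t ≤ toℕ i'
       × ((val π s + k ≤ val π t) ⊎ (val π t + k ≤ val π s)))
lemma2p7 n _ k 1≤k _ π i j i' j' γ δ j<i' with kJump? k (val π) j i'
... | yes jump = jump
... | no ¬jump = ⊥-elim (maximal-sections-separated 1≤k π γ δ j<i'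
                           (¬kJump⇒noDown 1≤k π ¬jump) (¬kJump⇒noUp 1≤k π ¬jump))
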